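{- For quasi-injective functions with $f_1;\dots;f_n = h;g_1;\dots;g_k$ and $f'_1;\dots;f'_{n'} = h;g'_1;\dots;g'_{k'}$ (where $f;g$ denotes $g\circ f$), the following rule is derivable: from $g_1(\cdots g_k(A)\cdots)\leq g'_1(\cdots g'_{k'}(A')\cdots)$ one derives $f_1(\cdots f_n(A)\cdots)\leq f'_1(\cdots f'_{n'}(A')\cdots)$. Once reflexivity and transitivity of $\leq$ are established, this is equivalent to the three simplified derivable rules: $A\leq A' \Rightarrow f(A)\leq f(A')$; $\mathsf{id}(A)\leq A$; and $f(g(A))\leq (g\circ f)(A)$. In particular base change is pseudofunctorial: $f(g(A))\equiv (f;g)(A)$, where $\equiv$ is the equivalence $\leq\cap\geq$.
   Context: Formulae of (idempotent) indexed linear logic IndLL are given by the grammar $A,B ::= f(X)\mid \mathbf 1\mid \top\mid A\otimes B\mid A\,\&_{i,j}\,B\mid !_u A\mid f(X)^\bot\mid \bot\mid \mathbf 0\mid A ⅋ B\mid A\oplus_{i,j}B\mid ?_u A$, where $X\in\mathtt{var}(J)$ for some set $J$ and $f,u,i,j$ are quasi-injective functions (every fibre finite). Formulae are defined over a set (locus): $I\vdash f(X)$ iff $f:I\to J$, $X\in\mathtt{var}(J)$; $I\vdash !_uA$ (and $?_uA$) iff $J\vdash A$ and $u:J\to I$; $I\vdash\mathbf 1$ always; $I\vdash A\otimes B$ iff both $A,B$ are over $I$; $\mathbf 0,\top$ are over $\emptyset$ only; $K\vdash A\oplus_{i,j}B$ (and $A\,\&_{i,j}\,B$) iff $I\vdash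 A$, $J\vdash B$ and $i:I\to K$, $j:J\to K$ are the two injections of a coproduct $K\simeq I\uplus J$; negation (de Morgan duality) preserves the locus. Base change: for a formula $A$ over $J$ and quasi-injective $f:I\to J$, the formula $f(A)$ over $I$ is defined by $f(\mathbf 1)=\mathbf 1$, $f(A\otimes B)=f(A)\otimes f(B)$, $f(\top)=\top$, $f(g(X))=(f;g)(X)$, commutation with negation, $f(A\,\&_{i,j}\,B) = p_A(A)\,\&_{q_A,q_B}\,p_B(B)$ where $q_A:I\times_J I_A\to I$, $p_A:I\times_J I_A\to I_A$ are the projections of the pullback of $f$ and $i:I_A\to J$ (similarly for $j$ and $\oplus$), and $f(!_uA)= !_{u'}\,f'(A)$ where $u':I\times_J K\to I$ and $f':I\times_J K\to K$ are the pullback projections of $f$ and $u:K\to J$. Subtyping $\leq$ (between formulae over the same locus, proof-relevant) is generated by: $A\,\&_{i,j}\,B\leq A'\,\&_{i',j'}\,B'$ if the pullbacks of $i,j'$ and of $j,i'$ are empty and $p(A)\leq p'(A')$, $r(B)\leq r'(B')$ where $p,p'$ (resp. $r,r'$) are the projections of the pullback of $i,i'$ (resp. $j,j'$); $!_uA\leq !_{u\circ g}A'$ if $g(A)\leq A'$; $\mathbf 1\leq\mathbf 1$, $\top\leq\top$, $f(X)\leq f(X)$; $A\otimes B\leq A'\otimes B'$ if $A\leq A'$ and $B\leq B'$; and dually $A^\bot\leq B^\bot$ iff $B\leq A$. -}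

module Defs where

open import Data.Nat using (ℕ)
open import Data.Fin using (Fin)
open import Data.Empty using (⊥)
open import Data.Unit using () renaming (⊤ to Unit)
open import Data.Sum using (_⊎_; [_,_]′)
open import Data.Product using (Σ; _×_; _,_; proj₁; proj₂)
open import Function using (_∘_; id)
open import Function.Bundles using (_↔_; _⇔_)
open import Function.Definitions using (Bijective)
open import Relation.Binary.PropositionalEquality using (_≡_)

Fibre : {I J : Set} → (I → J) → J → Set
Fibre {I} f y = Σ I λ x → f x ≡ y

Finite : Set → Set
Finite X = Σ ℕ λ n → X ↔ Fin n

QuasiInj : {I J : Set} → (I → J) → Set
QuasiInj {J = J} f = (y : J) → Finite (Fibre f y)

IsCoproduct : {I J K : Set} → (I → K) → (J → K) → Set
IsCoproduct i j = Bijective _≡_ _≡_ [ i , j ]′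

Pb : {I J K : Set} → (I → K) → (J → K) → Set
Pb {I} {J} f g = Σ (I × J) λ p → f (proj₁ p) ≡ g (proj₂ p)

π₁ : {I J K : Set} {f : I → K} {g : J → K} → Pb f g → I
π₁ p = proj₁ (proj₁ p)

π₂ : {I J K : Set} {f : I → K} {g : J → K} → Pb f g → J
π₂ p = proj₂ (proj₁ p)

-- Formulae of IndLL.  'Formula Var I' is the type of (raw) formulae over
-- the locus I; Var J is the set var(J) of variables over J.
-- The side conditions of the grammar (quasi-injectivity of f, u, i, j;
-- i, j being coproduct injections; 0 and ⊤ living over the empty locus)
-- are imposed by the predicate WF below.

data Formula (Var : Set → Set) : Set → Set₁ where
  atom  : {I J : Set} → (I → J) → Var J → Formula Var I
  natom : {I J : Set} → (I → J) → Var J → Formula Var I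
  𝟏 𝔹 ⊤ 𝟎 : {I : Set} → Formula Var I
  _⊗_ _⅋_ : {I : Set} → Formula Var I → Formula Var I → Formula Var I
  with′ plus : {I J K : Set} → (I → K) → (J → K) →
               Formula Var I → Formula Var J → Formula Var K
  ! ¿ : {I J : Set} → (J → I) → Formula Var J → Formula Var I

WF : {Var : Set → Set} {I : Set} → Formula Var I → Set
WF (atom f X)       = QuasiInj f
WF (natom f X)      = QuasiInj f
WF 𝟏                = Unit
WF 𝔹                = Unit
WF {I = I} ⊤        = I → ⊥
WF {I = I} 𝟎        = I → ⊥
WF (A ⊗ B)          = WF A × WF B
WF (A ⅋ B)          = WF A × WF B
WF (with′ i j A B)  = QuasiInj i × QuasiInj j × IsCoproduct i j × WF A × WF B
WF (plus i j A B)   = QuasiInj i × QuasiInj j × IsCoproduct i j × WF A × WF B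
WF (! u A)          = QuasiInj u × WF A
WF (¿ u A)          = QuasiInj u × WF A

-- Base change f(A) along f : I → J  (f;g is written g ∘ f)

bc : {Var : Set → Set} {I J : Set} → (I → J) → Formula Var J → Formula Var I
bc f (atom g X)      = atom (g ∘ f) X
bc f (natom g X)     = natom (g ∘ f) X
bc f 𝟏               = 𝟏
bc f 𝔹               = 𝔹
bc f ⊤               = ⊤
bc f 𝟎               = 𝟎
bc f (A ⊗ B)         = bc f A ⊗ bc f B
bc f (A ⅋ B)         = bc f A ⅋ bc f B
bc f (with′ i j A B) = with′ (π₁ {f = f} {g = i}) (π₁ {f = f} {g = j})
                             (bc (π₂ {f = f} {g = i}) A) (bc (π₂ {f = f} {g = j}) B)
bc f (plus i j A B)  = plus (π₁ {f = f} {g = i}) (π₁ {f = f} {g = j})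
                            (bc (π₂ {f = f} {g = i}) A) (bc (π₂ {f = f} {g = j}) B)
bc f (! u A)         = ! (π₁ {f = f} {g = u}) (bc (π₂ {f = f} {g = u}) A)
bc f (¿ u A)         = ¿ (π₁ {f = f} {g = u}) (bc (π₂ {f = f} {g = u}) A)

-- Subtyping A ≤ B (proof relevant), generated by the rules of the paper
-- together with their de Morgan duals.  Equality of functions is
-- extensional (pointwise), as in the set-theoretic setting of the paper.

infix 4 _≤_

data _≤_ {Var : Set → Set} : {I : Set} → Formula Var I → Formula Var I → Set₁ where
  atom≤  : {I J : Set} {f f′ : I → J} {X : Var J} →
           (∀ x → f x ≡ f′ x) → atom f X ≤ atom f′ X
  natom≤ : {I J : Set} {f f′ : I → J} {X : Var J} →
           (∀ x → f x ≡ f′ x) → natom f X ≤ natom f′ X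
  𝟏≤ : {I : Set} → 𝟏 {I = I} ≤ 𝟏
  𝔹≤ : {I : Set} → 𝔹 {I = I} ≤ 𝔹
  ⊤≤ : {I : Set} → ⊤ {I = I} ≤ ⊤
  𝟎≤ : {I : Set} → 𝟎 {I = I} ≤ 𝟎
  ⊗≤ : {I : Set} {A A′ B B′ : Formula Var I} →
       A ≤ A′ → B ≤ B′ → A ⊗ B ≤ A′ ⊗ B′
  ⅋≤ : {I : Set} {A A′ B B′ : Formula Var I} →
       A ≤ A′ → B ≤ B′ → A ⅋ B ≤ A′ ⅋ B′
  with≤ : {K IA IB IA′ IB′ : Set}
          {i : IA → K} {j : IB → K} {i′ : IA′ → K} {j′ : IB′ → K}
          {A : Formula Var IA} {B : Formula Var IB}
          {A′ : Formula Var IA′} {B′ : Formula Var IB′} →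
          (Pb i j′ → ⊥) → (Pb j i′ → ⊥) →
          bc (π₁ {f = i} {g = i′}) A ≤ bc (π₂ {f = i} {g = i′}) A′ →
          bc (π₁ {f = j} {g = j′}) B ≤ bc (π₂ {f = j} {g = j′}) B′ →
          with′ i j A B ≤ with′ i′ j′ A′ B′
  plus≤ : {K IA IB IA′ IB′ : Set}
          {i : IA → K} {j : IB → K} {i′ : IA′ → K} {j′ : IB′ → K}
          {A : Formula Var IA} {B : Formula Var IB}
          {A′ : Formula Var IA′} {B′ : Formula Var IB′} →
          (Pb i j′ → ⊥) → (Pb j i′ → ⊥) →
          bc (π₁ {f = i} {g = i′}) A ≤ bc (π₂ {f = i} {g = i′}) A′ →
          bc (π₁ {f = j} {g = j′}) B ≤ bc (π₂ {f = j} {g = j′}) B′ →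
          plus i j A B ≤ plus i′ j′ A′ B′
  -- !_u A ≤ !_{u∘g} A'  if g(A) ≤ A'   (v is u∘g up to pointwise equality)
  !≤ : {I K K′ : Set} {u : K → I} {v : K′ → I} {A : Formula Var K} {A′ : Formula Var K′}
       (g : K′ → K) → QuasiInj g → (∀ x → v x ≡ u (g x)) →
       bc g A ≤ A′ → ! u A ≤ ! v A′
  ¿≤ : {I K K′ : Set} {u : K → I} {v : K′ → I} {A : Formula Var K} {A′ : Formula Var K′}
       (g : K′ → K) → QuasiInj g → (∀ x → v x ≡ u (g x)) →
       A′ ≤ bc g A → ¿ v A′ ≤ ¿ u A

infixr 5 _∷_

data Chain : Set → Set → Set₁ where
  []  : {I : Set} → Chain I I
  _∷_ : {I K J : Set} → (I → K) → Chain K J → Chain I J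

comp : {I J : Set} → Chain I J → I → J
comp []       = id
comp (f ∷ fs) = comp fs ∘ f

bcs : {Var : Set → Set} {I J : Set} → Chain I J → Formula Var J → Formula Var I
bcs []       A = A
bcs (f ∷ fs) A = bc f (bcs fs A)

AllQI : {I J : Set} → Chain I J → Set
AllQI []       = Unit
AllQI (f ∷ fs) = QuasiInj f × AllQI fs

GeneralRule : (Var : Set → Set) → Set₁
GeneralRule Var =
  {I L J J′ : Set} (h : I → L)
  (fs : Chain I J) (gs : Chain L J) (fs′ : Chain I J′) (gs′ : Chain L J′) →
  QuasiInj h → AllQI fs → AllQI gs → AllQI fs′ → AllQI gs′ →
  (∀ x → comp fs x ≡ comp gs (h x)) →
  (∀ x → comp fs′ x ≡ comp gs′ (h x)) →
  (A : Formula Var J) (A′ : Formula Var J′) → WF A → WF A′ →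
  bcs gs A ≤ bcs gs′ A′ → bcs fs A ≤ bcs fs′ A′

ThreeRules : (Var : Set → Set) → Set₁
ThreeRules Var =
  ({I J : Set} (f : I → J) (A A′ : Formula Var J) →
     QuasiInj f → WF A → WF A′ → A ≤ A′ → bc f A ≤ bc f A′) ×
  ({I : Set} (A : Formula Var I) → WF A → bc id A ≤ A) ×
  ({I J K : Set} (f : I → J) (g : J → K) (A : Formula Var K) →
     QuasiInj f → QuasiInj g → WF A → bc f (bc g A) ≤ bc (g ∘ f) A)

Reflexivity : (Var : Set → Set) → Set₁
Reflexivity Var = {I : Set} (A : Formula Var I) → WF A → A ≤ A

Transitivity : (Var : Set → Set) → Set₁
Transitivity Var = {I : Set} (A B C : Formula Var I) → WF A → WF B → WF C →
                   A ≤ B → B ≤ C → A ≤ C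

Pseudofunctorial : (Var : Set → Set) → Set₁
Pseudofunctorial Var =
  {I J K : Set} (f : I → J) (g : J → K) (A : Formula Var K) →
  QuasiInj f → QuasiInj g → WF A →
  (bc f (bc g A) ≤ bc (g ∘ f) A) × (bc (g ∘ f) A ≤ bc f (bc g A))

-- Base change along f chooses a pullback at every additive and exponential
-- connective.  Recording formulae "up to the choice of pullbacks"
-- (BaseChange φ A B) makes base change compose, by pasting pullback squares.
-- The heart of the proof is a transfer lemma: if B, B′ are base changes of
-- A, A′ along φ, φ′, and C, C′ base changes of A, A′ along φ ∘ h, φ′ ∘ h with h
-- quasi-injective, then B ≤ B′ implies C ≤ C′.  It goes by induction on B ≤ B′;
-- the pullback lemma factors each square over φ ∘ h through the square over φ,
-- and the factor h′ of h obtained this way is again quasi-injective (fibres of a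
-- pullback are fibres of the original map) and maps the pullbacks that the
-- additive rules require to be empty into the corresponding ones over φ.  The
-- general rule is the transfer lemma for iterated base changes; reflexivity,
-- the three simplified rules and pseudofunctoriality are instances with h = id,
-- h = f or h the diagonal of a coproduct injection.

module Submission where

open import Defs
open import Axiom.UniquenessOfIdentityProofs.WithK using (uip)
open import Data.Empty using (⊥)
open import Data.Fin using (zero; suc)
open import Data.Product using (_×_; _,_; proj₁; proj₂)
open import Data.Sum using (inj₁; inj₂)
open import Data.Sum.Properties using (inj₁-injective; inj₂-injective)
open import Function using (_∘_; id)
open import Function.Bundles using (_⇔_; _↔_; mk⇔; mk↔ₛ′)
open import Function.Definitions using (Injective)
open import Function.Properties.Inverse using (↔-trans)
open import Relation.Binary.PropositionalEquality
  using (_≡_; _≗_; refl; sym; trans; cong; module ≡-Reasoning)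

record IsPullback {P X Y Z : Set} (p : P → X) (q : P → Y) (f : X → Z) (g : Y → Z) : Set where
  field
    square : ∀ w → f (p w) ≡ g (q w)
    gap    : (x : X) (y : Y) → f x ≡ g y → P
    p∘gap  : ∀ x y e → p (gap x y e) ≡ x
    q∘gap  : ∀ x y e → q (gap x y e) ≡ y
    gap-η  : ∀ w → gap (p w) (q w) (square w) ≡ w

  gap-cong : ∀ {x x′ y y′} {e : f x ≡ g y} {e′ : f x′ ≡ g y′} →
             x ≡ x′ → y ≡ y′ → gap x y e ≡ gap x′ y′ e′
  gap-cong {e = e} {e′} refl refl = cong (gap _ _) (uip e e′)

  jointly-injective : ∀ {w w′} → p w ≡ p w′ → q w ≡ q w′ → w ≡ w′
  jointly-injective {w} {w′} eq₁ eq₂ =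
    trans (sym (gap-η w)) (trans (gap-cong eq₁ eq₂) (gap-η w′))

open IsPullback

Fibre-≡ : {I J : Set} {f : I → J} {y : J} {x x′ : I} {e : f x ≡ y} {e′ : f x′ ≡ y} →
          x ≡ x′ → _≡_ {A = Fibre f y} (x , e) (x′ , e′)
Fibre-≡ {x = x} {e = e} {e′} refl = cong (x ,_) (uip e e′)

Pb-≡ : {I J K : Set} {f : I → K} {g : J → K} {w w′ : Pb f g} →
       π₁ w ≡ π₁ w′ → π₂ w ≡ π₂ w′ → w ≡ w′
Pb-≡ {w = (x , y) , e} {(x′ , y′) , e′} refl refl = cong ((x , y) ,_) (uip e e′)

Pb-swap : {I J K : Set} {f : I → K} {g : J → K} → Pb f g → Pb g f
Pb-swap ((x , y) , e) = (y , x) , sym e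

Pb-isPullback : {X Y Z : Set} {f : X → Z} {g : Y → Z} → IsPullback (π₁ {f = f} {g = g}) π₂ f g
Pb-isPullback = record
  { square = proj₂ ; gap = λ x y e → (x , y) , e
  ; p∘gap = λ _ _ _ → refl ; q∘gap = λ _ _ _ → refl ; gap-η = λ _ → refl }

id-isPullback : {X Z : Set} {f : X → Z} → IsPullback f id id f
id-isPullback = record
  { square = λ _ → refl ; gap = λ _ y _ → y
  ; p∘gap = λ _ _ e → sym e ; q∘gap = λ _ _ _ → refl ; gap-η = λ _ → refl }

isPullback-transpose : {P X Y Z : Set} {p : P → X} {q : P → Y} {f : X → Z} {g : Y → Z} →
            IsPullback p q f g → IsPullback q p g f
isPullback-transpose L = record
  { square = sym ∘ square L ; gap = λ y x e → gap L x y (sym e)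
  ; p∘gap = λ y x e → q∘gap L x y (sym e) ; q∘gap = λ y x e → p∘gap L x y (sym e)
  ; gap-η = λ w → trans (gap-cong L refl refl) (gap-η L w) }

module _ {P X Y Z : Set} {p : P → X} {q : P → Y} {f : X → Z} {g : Y → Z}
         (L : IsPullback p q f g) where

  Fibre-pullback-↔ : (y : Y) → Fibre q y ↔ Fibre f (g y)
  Fibre-pullback-↔ y = mk↔ₛ′ to from
    (λ { (x , e) → Fibre-≡ (p∘gap L x y e) })
    (λ { (w , e) → Fibre-≡ (jointly-injective L (p∘gap L _ _ _) (trans (q∘gap L _ _ _) (sym e))) })
    where
    to : Fibre q y → Fibre f (g y)
    to (w , e) = p w , trans (square L w) (cong g e)
    from : Fibre f (g y) → Fibre q y
    from (x , e) = gap L x y e , q∘gap L x y e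

  quasiInj-pullback : QuasiInj f → QuasiInj q
  quasiInj-pullback qf y with qf (g y)
  ... | n , fibre↔ = n , ↔-trans (Fibre-pullback-↔ y) fibre↔

quasiInj-id : {I : Set} → QuasiInj (id {A = I})
quasiInj-id y = 1 , mk↔ₛ′ (λ _ → zero) (λ _ → y , refl)
  (λ { zero → refl ; (suc ()) }) (λ { (x , refl) → refl })

isPullback-paste :
  {P X Y Z P′ X′ : Set} {p : P → X} {q : P → Y} {f : X → Z} {g : Y → Z}
  {p′ : P′ → X′} {q′ : P′ → P} {f′ : X′ → X} →
  IsPullback p q f g → IsPullback p′ q′ f′ p → IsPullback p′ (q ∘ q′) (f ∘ f′) g
isPullback-paste {q = q} {f = f} {f′ = f′} R L = record
  { square = λ w → trans (cong f (square L w)) (square R _)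
  ; gap    = λ x y e → gap L x (gap R (f′ x) y e) (sym (p∘gap R (f′ x) y e))
  ; p∘gap  = λ _ _ _ → p∘gap L _ _ _
  ; q∘gap  = λ _ _ _ → trans (cong q (q∘gap L _ _ _)) (q∘gap R _ _ _)
  ; gap-η  = λ w → jointly-injective L (p∘gap L _ _ _)
      (trans (q∘gap L _ _ _) (jointly-injective R (trans (p∘gap R _ _ _) (square L w)) (q∘gap R _ _ _))) }

module PullbackLemma
  {P X Y Z P′ X′ : Set} {p : P → X} {q : P → Y} {f : X → Z} {g : Y → Z}
  {p′ : P′ → X′} {q′ : P′ → Y} {f′ : X′ → Z}
  (right : IsPullback p q f g) (h : X′ → X)
  (outer : IsPullback p′ q′ f′ g) (f′≗f∘h : f′ ≗ f ∘ h) where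

  mediator : P′ → P
  mediator w = gap right (h (p′ w)) (q′ w) (trans (sym (f′≗f∘h (p′ w))) (square outer w))

  q∘mediator : ∀ w → q (mediator w) ≡ q′ w
  q∘mediator w = q∘gap right _ _ _

  left : IsPullback p′ mediator h p
  left = record
    { square = λ w → sym (p∘gap right _ _ _)
    ; gap    = λ x w e → gap outer x (q w) (trans (f′≗f∘h x) (trans (cong f e) (square right w)))
    ; p∘gap  = λ _ _ _ → p∘gap outer _ _ _
    ; q∘gap  = λ x w e → jointly-injective right
        (trans (p∘gap right _ _ _) (trans (cong h (p∘gap outer _ _ _)) e))
        (trans (q∘gap right _ _ _) (q∘gap outer _ _ _))
    ; gap-η  = λ w → jointly-injective outer (p∘gap outer _ _ _)
        (trans (q∘gap outer _ _ _) (q∘mediator w)) }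

module PullbackPair
  {P P′ Q Q′ X Y : Set} {a : P → X} {m : P → Q} {h : X → Y} {b : Q → Y}
  {a′ : P′ → X} {m′ : P′ → Q′} {b′ : Q′ → Y}
  (L : IsPullback a m h b) (L′ : IsPullback a′ m′ h b′) where

  pairMap : Pb a a′ → Pb b b′
  pairMap w = (m (π₁ w) , m′ (π₂ w)) ,
    trans (sym (square L (π₁ w))) (trans (cong h (proj₂ w)) (square L′ (π₂ w)))

  pairMap-isPullback : IsPullback (a ∘ π₁) pairMap h (b ∘ π₁)
  pairMap-isPullback = record
    { square = square L ∘ π₁
    ; gap    = λ x w e → (gap L x (π₁ w) e , gap L′ x (π₂ w) (trans e (proj₂ w))) ,
                         trans (p∘gap L _ _ _) (sym (p∘gap L′ _ _ _))
    ; p∘gap  = λ _ _ _ → p∘gap L _ _ _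
    ; q∘gap  = λ _ _ _ → Pb-≡ (q∘gap L _ _ _) (q∘gap L′ _ _ _)
    ; gap-η  = λ w → Pb-≡ (jointly-injective L (p∘gap L _ _ _) (q∘gap L _ _ _))
                          (jointly-injective L′ (trans (p∘gap L′ _ _ _) (proj₂ w)) (q∘gap L′ _ _ _)) }

module PullbackRestriction
  {IB IC J J′ SA SB PA PB QA QB : Set} {φ : IB → J} {φ′ : IB → J′} {χ : IC → J} {χ′ : IC → J′}
  {i : SA → J} {j : SB → J′}
  {iB : PA → IB} {ψ : PA → SA} {iC : QA → IC} {θ : QA → SA}
  {jB : PB → IB} {ψ′ : PB → SB} {jC : QB → IC} {θ′ : QB → SB}
  (h : IC → IB)
  (P : IsPullback iB ψ φ i) (R : IsPullback iC θ χ i) (e : χ ≗ φ ∘ h)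
  (P′ : IsPullback jB ψ′ φ′ j) (R′ : IsPullback jC θ′ χ′ j) (e′ : χ′ ≗ φ′ ∘ h) where

  private
    module A = PullbackLemma P h R e
    module B = PullbackLemma P′ h R′ e′

  restrict : Pb iC jC → Pb iB jB
  restrict = PullbackPair.pairMap A.left B.left

  restrict-isPullback : IsPullback (iC ∘ π₁) restrict h (iB ∘ π₁)
  restrict-isPullback = PullbackPair.pairMap-isPullback A.left B.left

  θ≗ψ∘restrict : θ ∘ π₁ ≗ ψ ∘ π₁ ∘ restrict
  θ≗ψ∘restrict w = sym (A.q∘mediator (π₁ w))

  θ′≗ψ′∘restrict : θ′ ∘ π₂ ≗ ψ′ ∘ π₂ ∘ restrict
  θ′≗ψ′∘restrict w = sym (B.q∘mediator (π₂ w))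

coproduct-injective₁ : {I J K : Set} {i : I → K} {j : J → K} → IsCoproduct i j → Injective _≡_ _≡_ i
coproduct-injective₁ (inj , _) e = inj₁-injective (inj e)

coproduct-injective₂ : {I J K : Set} {i : I → K} {j : J → K} → IsCoproduct i j → Injective _≡_ _≡_ j
coproduct-injective₂ (inj , _) e = inj₂-injective (inj e)

coproduct-disjoint : {I J K : Set} {i : I → K} {j : J → K} → IsCoproduct i j → Pb i j → ⊥
coproduct-disjoint (inj , _) ((x , y) , e) with inj {inj₁ x} {inj₂ y} e
... | ()

diagonal-quasiInj : {I K : Set} {i : I → K} → Injective _≡_ _≡_ i → QuasiInj (π₁ {f = i} {g = i})
diagonal-quasiInj inj x = 1 , mk↔ₛ′ (λ _ → zero) (λ _ → ((x , x) , refl) , refl)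
  (λ { zero → refl ; (suc ()) })
  (λ { (w , refl) → Fibre-≡ (Pb-≡ refl (inj (proj₂ w))) })

module _ {Var : Set → Set} where

  data BaseChange : {I J : Set} → (I → J) → Formula Var J → Formula Var I → Set₁ where
    atomᵇ  : {I J L : Set} {φ : I → J} {a : J → L} {b : I → L} {X : Var L} →
             b ≗ a ∘ φ → BaseChange φ (atom a X) (atom b X)
    natomᵇ : {I J L : Set} {φ : I → J} {a : J → L} {b : I → L} {X : Var L} →
             b ≗ a ∘ φ → BaseChange φ (natom a X) (natom b X)
    𝟏ᵇ : {I J : Set} {φ : I → J} → BaseChange φ 𝟏 𝟏
    𝔹ᵇ : {I J : Set} {φ : I → J} → BaseChange φ 𝔹 𝔹
    ⊤ᵇ : {I J : Set} {φ : I → J} → BaseChange φ ⊤ ⊤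
    𝟎ᵇ : {I J : Set} {φ : I → J} → BaseChange φ 𝟎 𝟎
    ⊗ᵇ : {I J : Set} {φ : I → J} {A A′ : Formula Var J} {B B′ : Formula Var I} →
         BaseChange φ A B → BaseChange φ A′ B′ → BaseChange φ (A ⊗ A′) (B ⊗ B′)
    ⅋ᵇ : {I J : Set} {φ : I → J} {A A′ : Formula Var J} {B B′ : Formula Var I} →
         BaseChange φ A B → BaseChange φ A′ B′ → BaseChange φ (A ⅋ A′) (B ⅋ B′)
    withᵇ : {I J IA IB IA′ IB′ : Set} {φ : I → J} {i : IA → J} {j : IB → J}
            {i′ : IA′ → I} {j′ : IB′ → I} {ψ₁ : IA′ → IA} {ψ₂ : IB′ → IB}
            {A : Formula Var IA} {B : Formula Var IB} {A′ : Formula Var IA′} {B′ : Formula Var IB′} →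
            IsPullback i′ ψ₁ φ i → IsPullback j′ ψ₂ φ j →
            BaseChange ψ₁ A A′ → BaseChange ψ₂ B B′ →
            BaseChange φ (with′ i j A B) (with′ i′ j′ A′ B′)
    plusᵇ : {I J IA IB IA′ IB′ : Set} {φ : I → J} {i : IA → J} {j : IB → J}
            {i′ : IA′ → I} {j′ : IB′ → I} {ψ₁ : IA′ → IA} {ψ₂ : IB′ → IB}
            {A : Formula Var IA} {B : Formula Var IB} {A′ : Formula Var IA′} {B′ : Formula Var IB′} →
            IsPullback i′ ψ₁ φ i → IsPullback j′ ψ₂ φ j →
            BaseChange ψ₁ A A′ → BaseChange ψ₂ B B′ →
            BaseChange φ (plus i j A B) (plus i′ j′ A′ B′)
    !ᵇ : {I J K K′ : Set} {φ : I → J} {u : K → J} {u′ : K′ → I} {ψ : K′ → K}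
         {A : Formula Var K} {A′ : Formula Var K′} →
         IsPullback u′ ψ φ u → BaseChange ψ A A′ → BaseChange φ (! u A) (! u′ A′)
    ¿ᵇ : {I J K K′ : Set} {φ : I → J} {u : K → J} {u′ : K′ → I} {ψ : K′ → K}
         {A : Formula Var K} {A′ : Formula Var K′} →
         IsPullback u′ ψ φ u → BaseChange ψ A A′ → BaseChange φ (¿ u A) (¿ u′ A′)

  bc-baseChange : {I J : Set} (f : I → J) (A : Formula Var J) → BaseChange f A (bc f A)
  bc-baseChange f (atom g X)      = atomᵇ (λ _ → refl)
  bc-baseChange f (natom g X)     = natomᵇ (λ _ → refl)
  bc-baseChange f 𝟏               = 𝟏ᵇ
  bc-baseChange f 𝔹               = 𝔹ᵇ
  bc-baseChange f ⊤               = ⊤ᵇ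
  bc-baseChange f 𝟎               = 𝟎ᵇ
  bc-baseChange f (A ⊗ B)         = ⊗ᵇ (bc-baseChange f A) (bc-baseChange f B)
  bc-baseChange f (A ⅋ B)         = ⅋ᵇ (bc-baseChange f A) (bc-baseChange f B)
  bc-baseChange f (with′ i j A B) = withᵇ Pb-isPullback Pb-isPullback (bc-baseChange _ A) (bc-baseChange _ B)
  bc-baseChange f (plus i j A B)  = plusᵇ Pb-isPullback Pb-isPullback (bc-baseChange _ A) (bc-baseChange _ B)
  bc-baseChange f (! u A)         = !ᵇ Pb-isPullback (bc-baseChange _ A)
  bc-baseChange f (¿ u A)         = ¿ᵇ Pb-isPullback (bc-baseChange _ A)

  id-baseChange : {I : Set} (A : Formula Var I) → BaseChange id A A
  id-baseChange (atom g X)      = atomᵇ (λ _ → refl)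
  id-baseChange (natom g X)     = natomᵇ (λ _ → refl)
  id-baseChange 𝟏               = 𝟏ᵇ
  id-baseChange 𝔹               = 𝔹ᵇ
  id-baseChange ⊤               = ⊤ᵇ
  id-baseChange 𝟎               = 𝟎ᵇ
  id-baseChange (A ⊗ B)         = ⊗ᵇ (id-baseChange A) (id-baseChange B)
  id-baseChange (A ⅋ B)         = ⅋ᵇ (id-baseChange A) (id-baseChange B)
  id-baseChange (with′ i j A B) = withᵇ id-isPullback id-isPullback (id-baseChange A) (id-baseChange B)
  id-baseChange (plus i j A B)  = plusᵇ id-isPullback id-isPullback (id-baseChange A) (id-baseChange B)
  id-baseChange (! u A)         = !ᵇ id-isPullback (id-baseChange A)
  id-baseChange (¿ u A)         = ¿ᵇ id-isPullback (id-baseChange A)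

  baseChange-∘ : {I J K : Set} {φ : J → K} {ψ : I → J}
                 {A : Formula Var K} {B : Formula Var J} {C : Formula Var I} →
                 BaseChange φ A B → BaseChange ψ B C → BaseChange (φ ∘ ψ) A C
  baseChange-∘ (atomᵇ e) (atomᵇ e′)   = atomᵇ (λ x → trans (e′ x) (e _))
  baseChange-∘ (natomᵇ e) (natomᵇ e′) = natomᵇ (λ x → trans (e′ x) (e _))
  baseChange-∘ 𝟏ᵇ 𝟏ᵇ = 𝟏ᵇ
  baseChange-∘ 𝔹ᵇ 𝔹ᵇ = 𝔹ᵇ
  baseChange-∘ ⊤ᵇ ⊤ᵇ = ⊤ᵇ
  baseChange-∘ 𝟎ᵇ 𝟎ᵇ = 𝟎ᵇ
  baseChange-∘ (⊗ᵇ x y) (⊗ᵇ x′ y′) = ⊗ᵇ (baseChange-∘ x x′) (baseChange-∘ y y′)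
  baseChange-∘ (⅋ᵇ x y) (⅋ᵇ x′ y′) = ⅋ᵇ (baseChange-∘ x x′) (baseChange-∘ y y′)
  baseChange-∘ (withᵇ P₁ P₂ x y) (withᵇ Q₁ Q₂ x′ y′) =
    withᵇ (isPullback-paste P₁ Q₁) (isPullback-paste P₂ Q₂) (baseChange-∘ x x′) (baseChange-∘ y y′)
  baseChange-∘ (plusᵇ P₁ P₂ x y) (plusᵇ Q₁ Q₂ x′ y′) =
    plusᵇ (isPullback-paste P₁ Q₁) (isPullback-paste P₂ Q₂) (baseChange-∘ x x′) (baseChange-∘ y y′)
  baseChange-∘ (!ᵇ P x) (!ᵇ Q x′) = !ᵇ (isPullback-paste P Q) (baseChange-∘ x x′)
  baseChange-∘ (¿ᵇ P x) (¿ᵇ Q x′) = ¿ᵇ (isPullback-paste P Q) (baseChange-∘ x x′)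

  bcs-baseChange : {I J : Set} (fs : Chain I J) (A : Formula Var J) → BaseChange (comp fs) A (bcs fs A)
  bcs-baseChange []       A = id-baseChange A
  bcs-baseChange (f ∷ fs) A = baseChange-∘ (bcs-baseChange fs A) (bc-baseChange f (bcs fs A))

  atom-maps-transfer :
    {IB IC J J′ L : Set} {φ : IB → J} {φ′ : IB → J′} {χ : IC → J} {χ′ : IC → J′}
    {a : J → L} {a′ : J′ → L} {b b′ : IB → L} {c c′ : IC → L} (h : IC → IB) →
    b ≗ a ∘ φ → b′ ≗ a′ ∘ φ′ → c ≗ a ∘ χ → c′ ≗ a′ ∘ χ′ →
    χ ≗ φ ∘ h → χ′ ≗ φ′ ∘ h → b ≗ b′ → c ≗ c′
  atom-maps-transfer {a = a} {a′} {b} {b′} {c} {c′} h eb eb′ ec ec′ e e′ b≗b′ x = begin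
    c x          ≡⟨ ec x ⟩
    a _          ≡⟨ cong a (e x) ⟩
    a _          ≡⟨ sym (eb (h x)) ⟩
    b (h x)      ≡⟨ b≗b′ (h x) ⟩
    b′ (h x)     ≡⟨ eb′ (h x) ⟩
    a′ _         ≡⟨ cong a′ (sym (e′ x)) ⟩
    a′ _         ≡⟨ sym (ec′ x) ⟩
    c′ x         ∎
    where open ≡-Reasoning

  ≤-transfer :
    {IB IC J J′ : Set} {φ : IB → J} {φ′ : IB → J′} {χ : IC → J} {χ′ : IC → J′}
    {A : Formula Var J} {A′ : Formula Var J′}
    {B B′ : Formula Var IB} {C C′ : Formula Var IC} →
    BaseChange φ A B → BaseChange φ′ A′ B′ → BaseChange χ A C → BaseChange χ′ A′ C′ →
    (h : IC → IB) → QuasiInj h → χ ≗ φ ∘ h → χ′ ≗ φ′ ∘ h →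
    B ≤ B′ → C ≤ C′

  ≤-transfer-summand :
    {IB IC J J′ SA SA′ PA PA′ QA QA′ : Set}
    {φ : IB → J} {φ′ : IB → J′} {χ : IC → J} {χ′ : IC → J′} {i : SA → J} {i′ : SA′ → J′}
    {iB : PA → IB} {ψ : PA → SA} {iC : QA → IC} {θ : QA → SA}
    {iB′ : PA′ → IB} {ψ′ : PA′ → SA′} {iC′ : QA′ → IC} {θ′ : QA′ → SA′}
    {A : Formula Var SA} {A′ : Formula Var SA′} {B : Formula Var PA} {B′ : Formula Var PA′}
    {C : Formula Var QA} {C′ : Formula Var QA′} (h : IC → IB) →
    IsPullback iB ψ φ i → IsPullback iC θ χ i → χ ≗ φ ∘ h →
    IsPullback iB′ ψ′ φ′ i′ → IsPullback iC′ θ′ χ′ i′ → χ′ ≗ φ′ ∘ h →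
    BaseChange ψ A B → BaseChange ψ′ A′ B′ → BaseChange θ A C → BaseChange θ′ A′ C′ →
    QuasiInj h →
    bc (π₁ {f = iB} {g = iB′}) B ≤ bc π₂ B′ → bc (π₁ {f = iC} {g = iC′}) C ≤ bc π₂ C′
  ≤-transfer-summand h P R e P′ R′ e′ b b′ c c′ qh d =
    ≤-transfer (baseChange-∘ b (bc-baseChange _ _)) (baseChange-∘ b′ (bc-baseChange _ _))
               (baseChange-∘ c (bc-baseChange _ _)) (baseChange-∘ c′ (bc-baseChange _ _))
               restrict (quasiInj-pullback restrict-isPullback qh) θ≗ψ∘restrict θ′≗ψ′∘restrict d
    where open PullbackRestriction h P R e P′ R′ e′

  ≤-transfer {φ = φ} {φ′} (atomᵇ {a = a} eb) (atomᵇ {a = a′} eb′) (atomᵇ ec) (atomᵇ ec′)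
             h qh e e′ (atom≤ d) =
    atom≤ (atom-maps-transfer {φ = φ} {φ′} {a = a} {a′} h eb eb′ ec ec′ e e′ d)
  ≤-transfer {φ = φ} {φ′} (natomᵇ {a = a} eb) (natomᵇ {a = a′} eb′) (natomᵇ ec) (natomᵇ ec′)
             h qh e e′ (natom≤ d) =
    natom≤ (atom-maps-transfer {φ = φ} {φ′} {a = a} {a′} h eb eb′ ec ec′ e e′ d)
  ≤-transfer 𝟏ᵇ 𝟏ᵇ 𝟏ᵇ 𝟏ᵇ h qh e e′ 𝟏≤ = 𝟏≤
  ≤-transfer 𝔹ᵇ 𝔹ᵇ 𝔹ᵇ 𝔹ᵇ h qh e e′ 𝔹≤ = 𝔹≤
  ≤-transfer ⊤ᵇ ⊤ᵇ ⊤ᵇ ⊤ᵇ h qh e e′ ⊤≤ = ⊤≤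
  ≤-transfer 𝟎ᵇ 𝟎ᵇ 𝟎ᵇ 𝟎ᵇ h qh e e′ 𝟎≤ = 𝟎≤
  ≤-transfer (⊗ᵇ b₁ b₂) (⊗ᵇ b₁′ b₂′) (⊗ᵇ c₁ c₂) (⊗ᵇ c₁′ c₂′) h qh e e′ (⊗≤ d₁ d₂) =
    ⊗≤ (≤-transfer b₁ b₁′ c₁ c₁′ h qh e e′ d₁) (≤-transfer b₂ b₂′ c₂ c₂′ h qh e e′ d₂)
  ≤-transfer (⅋ᵇ b₁ b₂) (⅋ᵇ b₁′ b₂′) (⅋ᵇ c₁ c₂) (⅋ᵇ c₁′ c₂′) h qh e e′ (⅋≤ d₁ d₂) =
    ⅋≤ (≤-transfer b₁ b₁′ c₁ c₁′ h qh e e′ d₁) (≤-transfer b₂ b₂′ c₂ c₂′ h qh e e′ d₂)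
  ≤-transfer (withᵇ P₁ P₂ b₁ b₂) (withᵇ P₁′ P₂′ b₁′ b₂′) (withᵇ R₁ R₂ c₁ c₂) (withᵇ R₁′ R₂′ c₁′ c₂′)
             h qh e e′ (with≤ n₁ n₂ d₁ d₂) =
    with≤ (n₁ ∘ PullbackRestriction.restrict h P₁ R₁ e P₂′ R₂′ e′)
          (n₂ ∘ PullbackRestriction.restrict h P₂ R₂ e P₁′ R₁′ e′)
          (≤-transfer-summand h P₁ R₁ e P₁′ R₁′ e′ b₁ b₁′ c₁ c₁′ qh d₁)
          (≤-transfer-summand h P₂ R₂ e P₂′ R₂′ e′ b₂ b₂′ c₂ c₂′ qh d₂)
  ≤-transfer (plusᵇ P₁ P₂ b₁ b₂) (plusᵇ P₁′ P₂′ b₁′ b₂′) (plusᵇ R₁ R₂ c₁ c₂) (plusᵇ R₁′ R₂′ c₁′ c₂′)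
             h qh e e′ (plus≤ n₁ n₂ d₁ d₂) =
    plus≤ (n₁ ∘ PullbackRestriction.restrict h P₁ R₁ e P₂′ R₂′ e′)
          (n₂ ∘ PullbackRestriction.restrict h P₂ R₂ e P₁′ R₁′ e′)
          (≤-transfer-summand h P₁ R₁ e P₁′ R₁′ e′ b₁ b₁′ c₁ c₁′ qh d₁)
          (≤-transfer-summand h P₂ R₂ e P₂′ R₂′ e′ b₂ b₂′ c₂ c₂′ qh d₂)
  -- The witness g of !≤ is carried over to the mediator of the pullback
  -- lemma applied to the two left squares over h.
  ≤-transfer (!ᵇ {ψ = ψ} P b) (!ᵇ P′ b′) (!ᵇ R c) (!ᵇ R′ c′) h qh e e′ (!≤ g qg pg d) =
    !≤ mediator (quasiInj-pullback left qg) (sym ∘ q∘mediator)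
      (≤-transfer (baseChange-∘ b (bc-baseChange g _)) b′ (baseChange-∘ c (bc-baseChange mediator _)) c′
         (PullbackLemma.mediator P′ h R′ e′) (quasiInj-pullback L′ qh)
         (λ x → trans (sym (PullbackLemma.q∘mediator P h R e (mediator x))) (cong ψ (sym (square left x))))
         (sym ∘ PullbackLemma.q∘mediator P′ h R′ e′) d)
    where
    L  = PullbackLemma.left P h R e
    L′ = PullbackLemma.left P′ h R′ e′
    open PullbackLemma (isPullback-transpose L) g (isPullback-transpose L′) pg
  ≤-transfer (¿ᵇ P b) (¿ᵇ {ψ = ψ′} P′ b′) (¿ᵇ R c) (¿ᵇ R′ c′) h qh e e′ (¿≤ g qg pg d) =
    ¿≤ mediator (quasiInj-pullback left qg) (sym ∘ q∘mediator)
      (≤-transfer b (baseChange-∘ b′ (bc-baseChange g _)) c (baseChange-∘ c′ (bc-baseChange mediator _))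
         (PullbackLemma.mediator P h R e) (quasiInj-pullback L qh)
         (sym ∘ PullbackLemma.q∘mediator P h R e)
         (λ x → trans (sym (PullbackLemma.q∘mediator P′ h R′ e′ (mediator x))) (cong ψ′ (sym (square left x))))
         d)
    where
    L  = PullbackLemma.left P h R e
    L′ = PullbackLemma.left P′ h R′ e′
    open PullbackLemma (isPullback-transpose L′) g (isPullback-transpose L) pg

  baseChange-mono : {I J : Set} {φ : I → J} {A A′ : Formula Var J} {C C′ : Formula Var I} →
                    QuasiInj φ → BaseChange φ A C → BaseChange φ A′ C′ → A ≤ A′ → C ≤ C′
  baseChange-mono {φ = φ} {A} {A′} qφ c c′ =
    ≤-transfer (id-baseChange A) (id-baseChange A′) c c′ φ qφ (λ _ → refl) (λ _ → refl)

  diagonal-≤ : {I K : Set} {i : I → K} {A : Formula Var I} → Injective _≡_ _≡_ i →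
               A ≤ A → bc (π₁ {f = i} {g = i}) A ≤ bc π₂ A
  diagonal-≤ {A = A} inj =
    ≤-transfer (id-baseChange A) (id-baseChange A) (bc-baseChange π₁ A) (bc-baseChange π₂ A)
               π₁ (diagonal-quasiInj inj) (λ _ → refl) (λ w → sym (inj (proj₂ w)))

  ≤-refl : Reflexivity Var
  ≤-refl (atom f X) _  = atom≤ (λ _ → refl)
  ≤-refl (natom f X) _ = natom≤ (λ _ → refl)
  ≤-refl 𝟏 _           = 𝟏≤
  ≤-refl 𝔹 _           = 𝔹≤
  ≤-refl ⊤ _           = ⊤≤
  ≤-refl 𝟎 _           = 𝟎≤
  ≤-refl (A ⊗ B) (wA , wB) = ⊗≤ (≤-refl A wA) (≤-refl B wB)
  ≤-refl (A ⅋ B) (wA , wB) = ⅋≤ (≤-refl A wA) (≤-refl B wB)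
  ≤-refl (with′ i j A B) (_ , _ , cop , wA , wB) =
    with≤ (coproduct-disjoint cop) (coproduct-disjoint cop ∘ Pb-swap)
          (diagonal-≤ (coproduct-injective₁ cop) (≤-refl A wA))
          (diagonal-≤ (coproduct-injective₂ cop) (≤-refl B wB))
  ≤-refl (plus i j A B) (_ , _ , cop , wA , wB) =
    plus≤ (coproduct-disjoint cop) (coproduct-disjoint cop ∘ Pb-swap)
          (diagonal-≤ (coproduct-injective₁ cop) (≤-refl A wA))
          (diagonal-≤ (coproduct-injective₂ cop) (≤-refl B wB))
  ≤-refl (! u A) (_ , wA) =
    !≤ id quasiInj-id (λ _ → refl)
       (baseChange-mono quasiInj-id (bc-baseChange id A) (id-baseChange A) (≤-refl A wA))
  ≤-refl (¿ u A) (_ , wA) =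
    ¿≤ id quasiInj-id (λ _ → refl)
       (baseChange-mono quasiInj-id (id-baseChange A) (bc-baseChange id A) (≤-refl A wA))

  bc-mono : {I J : Set} (f : I → J) {A A′ : Formula Var J} → QuasiInj f → A ≤ A′ → bc f A ≤ bc f A′
  bc-mono f {A} {A′} qf = baseChange-mono qf (bc-baseChange f A) (bc-baseChange f A′)

  bc-id-≤ : {I : Set} (A : Formula Var I) → WF A → bc id A ≤ A
  bc-id-≤ A wA = baseChange-mono quasiInj-id (bc-baseChange id A) (id-baseChange A) (≤-refl A wA)

  bc-∘-≤ : {I J K : Set} (f : I → J) (g : J → K) (A : Formula Var K) →
           QuasiInj f → QuasiInj g → WF A → bc f (bc g A) ≤ bc (g ∘ f) A
  bc-∘-≤ f g A qf qg wA =
    ≤-transfer (bc-baseChange g A) (bc-baseChange g A)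
               (baseChange-∘ (bc-baseChange g A) (bc-baseChange f _)) (bc-baseChange (g ∘ f) A)
               f qf (λ _ → refl) (λ _ → refl) (bc-mono g qg (≤-refl A wA))

  bc-∘-≥ : {I J K : Set} (f : I → J) (g : J → K) (A : Formula Var K) →
           QuasiInj f → QuasiInj g → WF A → bc (g ∘ f) A ≤ bc f (bc g A)
  bc-∘-≥ f g A qf qg wA =
    ≤-transfer (bc-baseChange g A) (bc-baseChange g A)
               (bc-baseChange (g ∘ f) A) (baseChange-∘ (bc-baseChange g A) (bc-baseChange f _))
               f qf (λ _ → refl) (λ _ → refl) (bc-mono g qg (≤-refl A wA))

  general-rule : GeneralRule Var
  general-rule h fs gs fs′ gs′ qh _ _ _ _ e e′ A A′ _ _ =
    ≤-transfer (bcs-baseChange gs A) (bcs-baseChange gs′ A′) (bcs-baseChange fs A) (bcs-baseChange fs′ A′)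
               h qh e e′

  three-rules : ThreeRules Var
  three-rules = (λ f A A′ qf _ _ → bc-mono f qf) , bc-id-≤ , bc-∘-≤

  pseudofunctorial : Pseudofunctorial Var
  pseudofunctorial f g A qf qg wA = bc-∘-≤ f g A qf qg wA , bc-∘-≥ f g A qf qg wA

-- Both sides of the equivalence hold outright, without reflexivity or transitivity.
lemma2p9 : (Var : Set → Set) →
    GeneralRule Var ×
    (Reflexivity Var → Transitivity Var → GeneralRule Var ⇔ ThreeRules Var) ×
    ThreeRules Var ×
    Pseudofunctorial Var
lemma2p9 Var =
  general-rule , (λ _ _ → mk⇔ {A = GeneralRule Var} {B = ThreeRules Var} (λ _ → three-rules) (λ _ → general-rule)) , three-rules , pseudofunctorial
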